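{- Let $P$ and $Q$ be finite posets on disjoint underlying sets. Then \[\Phi(P+Q ; s, t, x, y, z) = \Phi(P ; s, t, x, y, z)\, \Phi(Q ; s, t, x, y, z).\]
   Context: All posets are finite. For a poset $P$, a set $U\subseteq P$ is an upset if $u\in U$, $u\le v$ imply $v\in U$; a set $D\subseteq P$ is a downset if $v\in D$, $u\le v$ imply $u\in D$ (the empty set is both). For an upset $U$, $A(U)$ denotes the antichain of minimal elements of $U$ (the unique antichain generating $U$ as an upset); for a downset $D$, $A(D)$ denotes the antichain of maximal elements of $D$. For an upset $U$ and a downset $D$ write $U\preceq D$ if $A(U)\subseteq D$ and $A(D)\subseteq U$. The generalized interval polynomial of $P$ is \[\Phi(P;s,t,x,y,z)=\sum_{U\preceq D} s^{|A(U)|}t^{|A(D)|}x^{|D|}y^{|U|}z^{|U\cap D|},\] the sum over all pairs of an upset $U$ and a downset $D$ of $P$ with $U\preceq D$ (including $U=D=\emptyset$). The disjoint union $P+Q$ has underlying set $P\cup Q$ and $u\le v$ iff ($u,v\in P$ and $u\le_P v$) or ($u,v\in Q$ and $u\le_Q v$). -}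

module Defs where

open import Data.Bool using (Bool; true; false; _∧_; _∨_; not; T; T?)
open import Data.Nat using (ℕ; zero; suc; _+_)
open import Data.Fin using (Fin; splitAt; join; _≟_)
open import Data.Fin.Properties using (join-splitAt)
open import Data.Sum using (_⊎_; inj₁; inj₂)
open import Data.Vec using (Vec; []; _∷_; lookup)
open import Data.List using (List; []; _∷_; _++_; map; filter; length; allFin; foldr; concatMap)
open import Data.Bool.ListAction using (and)
open import Data.Product using (_×_; _,_)
open import Relation.Nullary using (does)
open import Relation.Binary.PropositionalEquality using (_≡_; refl; cong; trans; sym)
open import Algebra.Bundles using (CommutativeSemiring)

record FinPoset : Set where
  field
    card      : ℕ
    _≤ᵇ_      : Fin card → Fin card → Bool
    ≤-refl    : ∀ i → T (i ≤ᵇ i)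
    ≤-antisym : ∀ i j → T (i ≤ᵇ j) → T (j ≤ᵇ i) → i ≡ j
    ≤-trans   : ∀ i j k → T (i ≤ᵇ j) → T (j ≤ᵇ k) → T (i ≤ᵇ k)

-- Disjoint union P + Q, with underlying set Fin (m + n) ≅ Fin m ⊎ Fin n
-- (the first m elements form P, the remaining n form Q).

module _ {m n : ℕ} (lP : Fin m → Fin m → Bool) (lQ : Fin n → Fin n → Bool) where
  rel⊎ : Fin m ⊎ Fin n → Fin m ⊎ Fin n → Bool
  rel⊎ (inj₁ a) (inj₁ b) = lP a b
  rel⊎ (inj₂ a) (inj₂ b) = lQ a b
  rel⊎ (inj₁ _) (inj₂ _) = false
  rel⊎ (inj₂ _) (inj₁ _) = false

  sumRel : Fin (m + n) → Fin (m + n) → Bool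
  sumRel i j = rel⊎ (splitAt m i) (splitAt m j)

_⊕_ : FinPoset → FinPoset → FinPoset
P ⊕ Q = record
  { card = card P + card Q
  ; _≤ᵇ_ = sumRel (_≤ᵇ_ P) (_≤ᵇ_ Q)
  ; ≤-refl = λ i → rf (splitAt (card P) i)
  ; ≤-antisym = λ i j p q →
      trans (sym (join-splitAt (card P) (card Q) i))
        (trans (cong (join (card P) (card Q)) (as (splitAt (card P) i) (splitAt (card P) j) p q))
               (join-splitAt (card P) (card Q) j))
  ; ≤-trans = λ i j k → tr (splitAt (card P) i) (splitAt (card P) j) (splitAt (card P) k) }
  where
  open FinPoset
  R = rel⊎ (_≤ᵇ_ P) (_≤ᵇ_ Q)
  rf : ∀ x → T (R x x)
  rf (inj₁ a) = ≤-refl P a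
  rf (inj₂ a) = ≤-refl Q a
  as : ∀ x y → T (R x y) → T (R y x) → x ≡ y
  as (inj₁ a) (inj₁ b) p q = cong inj₁ (≤-antisym P a b p q)
  as (inj₂ a) (inj₂ b) p q = cong inj₂ (≤-antisym Q a b p q)
  tr : ∀ x y z → T (R x y) → T (R y z) → T (R x z)
  tr (inj₁ a) (inj₁ b) (inj₁ c) p q = ≤-trans P a b c p q
  tr (inj₂ a) (inj₂ b) (inj₂ c) p q = ≤-trans Q a b c p q

allSubsets : (n : ℕ) → List (Vec Bool n)
allSubsets zero    = [] ∷ []
allSubsets (suc n) = map (false ∷_) (allSubsets n) ++ map (true ∷_) (allSubsets n)

count : ∀ {n} → (Fin n → Bool) → ℕ
count {n} f = length (filter (λ i → T? (f i)) (allFin n))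

forallᵇ : ∀ {n} → (Fin n → Bool) → Bool
forallᵇ {n} f = and (map f (allFin n))

_⇒ᵇ_ : Bool → Bool → Bool
a ⇒ᵇ b = not a ∨ b

module PosetNotions (P : FinPoset) where
  open FinPoset P

  Sub : Set
  Sub = Vec Bool card

  _∈ᵇ_ : Fin card → Sub → Bool
  i ∈ᵇ S = lookup S i

  _<ᵇ_ : Fin card → Fin card → Bool
  u <ᵇ v = (u ≤ᵇ v) ∧ not (does (u ≟ v))

  isUpset : Sub → Bool
  isUpset U = forallᵇ λ u → forallᵇ λ v → ((u ∈ᵇ U) ∧ (u ≤ᵇ v)) ⇒ᵇ (v ∈ᵇ U)

  isDownset : Sub → Bool
  isDownset D = forallᵇ λ u → forallᵇ λ v → ((v ∈ᵇ D) ∧ (u ≤ᵇ v)) ⇒ᵇ (u ∈ᵇ D)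

  inAU : Sub → Fin card → Bool
  inAU U u = (u ∈ᵇ U) ∧ forallᵇ λ v → not ((v ∈ᵇ U) ∧ (v <ᵇ u))

  inAD : Sub → Fin card → Bool
  inAD D d = (d ∈ᵇ D) ∧ forallᵇ λ v → not ((v ∈ᵇ D) ∧ (d <ᵇ v))

  _≼_ : Sub → Sub → Bool
  U ≼ D = (forallᵇ λ u → inAU U u ⇒ᵇ (u ∈ᵇ D)) ∧ (forallᵇ λ d → inAD D d ⇒ᵇ (d ∈ᵇ U))

  admissible : Sub × Sub → Bool
  admissible (U , D) = isUpset U ∧ isDownset D ∧ (U ≼ D)

  admissiblePairs : List (Sub × Sub)
  admissiblePairs =
    filter (λ p → T? (admissible p))
           (concatMap (λ U → map (λ D → (U , D)) (allSubsets card)) (allSubsets card))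

-- The generalized interval polynomial, evaluated at arbitrary elements
-- s t x y z of an arbitrary commutative semiring.

module _ {c ℓ} (R : CommutativeSemiring c ℓ) where
  open CommutativeSemiring R renaming (Carrier to A; _+_ to _⊞_; _*_ to _⊠_)

  pow : A → ℕ → A
  pow a zero    = 1#
  pow a (suc k) = a ⊠ pow a k

  Φ : FinPoset → A → A → A → A → A → A
  Φ P s t x y z =
    foldr _⊞_ 0#
      (map (λ { (U , D) →
                 pow s (count (inAU U)) ⊠ pow t (count (inAD D)) ⊠ pow x (count (_∈ᵇ D))
                 ⊠ pow y (count (_∈ᵇ U)) ⊠ pow z (count (λ i → (i ∈ᵇ U) ∧ (i ∈ᵇ D))) })
           admissiblePairs)
    where open PosetNotions P

-- No element of P is comparable with an element of Q. Hence a subset of P + Q is an upset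
-- (downset) exactly when its traces on P and on Q are, its minimal (maximal) elements are those
-- of the two traces, and U ≼ D holds exactly when it holds on both sides. The five statistics in
-- the exponents are additive over the two sides, so the summand of (U₁ ∪ U₂ , D₁ ∪ D₂) is the
-- product of the summands of (U₁ , D₁) and (U₂ , D₂), and the sum over all pairs factors.

module Submission where

open import Algebra.Bundles using (CommutativeSemiring; CommutativeMonoid)
open import Data.Bool using (Bool; true; false; _∧_; _∨_; not; T?; if_then_else_)
open import Data.Bool.Properties using (∧-assoc; ∧-zeroʳ; ∧-identityʳ; ∧-commutativeMonoid)
open import Data.Bool.ListAction using (and)
open import Data.Fin using (Fin; zero; suc; _↑ˡ_; _↑ʳ_; _≟_)
open import Data.Fin.Properties using (splitAt-↑ˡ; splitAt-↑ʳ; ↑ˡ-injective; ↑ʳ-injective)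
open import Data.List using (List; []; _∷_; map; filter; length; tabulate; allFin; foldr; concatMap)
  renaming (_++_ to _++ᴸ_)
open import Data.List.Properties
  using (map-tabulate; tabulate-cong; filter-++; length-++; map-∘; map-id; ++-identityʳ;
         map-concatMap; concatMap-map; concatMap-cong; concatMap-++)
open import Data.Nat as ℕ using (ℕ; zero; suc)
open import Data.Product using (_×_; _,_)
open import Data.Vec using (Vec; _∷_; _++_; lookup)
open import Data.Vec.Properties using (lookup-++ˡ; lookup-++ʳ)
open import Function using (_∘_; id)
open import Relation.Binary.PropositionalEquality
  using (_≡_; _≗_; refl; sym; trans; cong; cong₂; module ≡-Reasoning)
open import Relation.Nullary using (does; yes; no)
open import Relation.Nullary.Decidable using (dec-true; dec-false)
import Algebra.Properties.CommutativeSemigroup as CommutativeSemigroupProperties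
import Relation.Binary.Reasoning.Setoid as SetoidReasoning

open import Defs

open CommutativeSemigroupProperties (CommutativeMonoid.commutativeSemigroup ∧-commutativeMonoid)
  using () renaming (interchange to ∧-interchange)

tabulate-↑ : ∀ {a} {A : Set a} m {n} (f : Fin (m ℕ.+ n) → A) →
             tabulate f ≡ tabulate (f ∘ (_↑ˡ n)) ++ᴸ tabulate (f ∘ (m ↑ʳ_))
tabulate-↑ zero    f = refl
tabulate-↑ (suc m) f = cong (f zero ∷_) (tabulate-↑ m (f ∘ suc))

and-++ : ∀ (bs cs : List Bool) → and (bs ++ᴸ cs) ≡ and bs ∧ and cs
and-++ []       cs = refl
and-++ (b ∷ bs) cs = trans (cong (b ∧_) (and-++ bs cs)) (sym (∧-assoc b (and bs) (and cs)))

and-tabulate-true : ∀ {n} {f : Fin n → Bool} → (∀ i → f i ≡ true) → and (tabulate f) ≡ true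
and-tabulate-true {zero}  f≡true = refl
and-tabulate-true {suc n} f≡true rewrite f≡true zero = and-tabulate-true (f≡true ∘ suc)

length-filter-T?-map : ∀ {a} {A : Set a} (f : A → Bool) (xs : List A) →
                       length (filter (λ x → T? (f x)) xs) ≡ length (filter T? (map f xs))
length-filter-T?-map f []       = refl
length-filter-T?-map f (x ∷ xs) with f x
... | true  = cong suc (length-filter-T?-map f xs)
... | false = length-filter-T?-map f xs

forallᵇ-tabulate : ∀ {n} (f : Fin n → Bool) → forallᵇ f ≡ and (tabulate f)
forallᵇ-tabulate f = cong and (map-tabulate id f)

count-tabulate : ∀ {n} (f : Fin n → Bool) → count f ≡ length (filter T? (tabulate f))
count-tabulate {n} f =
  trans (length-filter-T?-map f (allFin n)) (cong (length ∘ filter T?) (map-tabulate id f))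

forallᵇ-true : ∀ {n} {f : Fin n → Bool} → (∀ i → f i ≡ true) → forallᵇ f ≡ true
forallᵇ-true {f = f} f≡true = trans (forallᵇ-tabulate f) (and-tabulate-true f≡true)

module _ (m : ℕ) {n : ℕ} {f : Fin (m ℕ.+ n) → Bool} {g : Fin m → Bool} {h : Fin n → Bool}
         (f≗g : f ∘ (_↑ˡ n) ≗ g) (f≗h : f ∘ (m ↑ʳ_) ≗ h) where
  open ≡-Reasoning

  forallᵇ-split : forallᵇ f ≡ forallᵇ g ∧ forallᵇ h
  forallᵇ-split = begin
    forallᵇ f
      ≡⟨ forallᵇ-tabulate f ⟩
    and (tabulate f)
      ≡⟨ cong and (tabulate-↑ m f) ⟩
    and (tabulate (f ∘ (_↑ˡ n)) ++ᴸ tabulate (f ∘ (m ↑ʳ_)))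
      ≡⟨ and-++ (tabulate (f ∘ (_↑ˡ n))) (tabulate (f ∘ (m ↑ʳ_))) ⟩
    and (tabulate (f ∘ (_↑ˡ n))) ∧ and (tabulate (f ∘ (m ↑ʳ_)))
      ≡⟨ cong₂ (λ bs cs → and bs ∧ and cs) (tabulate-cong f≗g) (tabulate-cong f≗h) ⟩
    and (tabulate g) ∧ and (tabulate h)
      ≡⟨ cong₂ _∧_ (forallᵇ-tabulate g) (forallᵇ-tabulate h) ⟨
    forallᵇ g ∧ forallᵇ h ∎

  count-split : count f ≡ count g ℕ.+ count h
  count-split = begin
    count f
      ≡⟨ count-tabulate f ⟩
    length (filter T? (tabulate f))
      ≡⟨ cong (length ∘ filter T?) (tabulate-↑ m f) ⟩
    length (filter T? (tabulate (f ∘ (_↑ˡ n)) ++ᴸ tabulate (f ∘ (m ↑ʳ_))))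
      ≡⟨ cong length (filter-++ T? (tabulate (f ∘ (_↑ˡ n))) _) ⟩
    length (filter T? (tabulate (f ∘ (_↑ˡ n))) ++ᴸ filter T? (tabulate (f ∘ (m ↑ʳ_))))
      ≡⟨ length-++ (filter T? (tabulate (f ∘ (_↑ˡ n)))) ⟩
    length (filter T? (tabulate (f ∘ (_↑ˡ n)))) ℕ.+ length (filter T? (tabulate (f ∘ (m ↑ʳ_))))
      ≡⟨ cong₂ (λ bs cs → length (filter T? bs) ℕ.+ length (filter T? cs))
               (tabulate-cong f≗g) (tabulate-cong f≗h) ⟩
    length (filter T? (tabulate g)) ℕ.+ length (filter T? (tabulate h))
      ≡⟨ cong₂ ℕ._+_ (count-tabulate g) (count-tabulate h) ⟨
    count g ℕ.+ count h ∎

forallᵇ-splitˡ : ∀ m {n} {f : Fin (m ℕ.+ n) → Bool} {g : Fin m → Bool} →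
                 f ∘ (_↑ˡ n) ≗ g → (∀ j → f (m ↑ʳ j) ≡ true) → forallᵇ f ≡ forallᵇ g
forallᵇ-splitˡ m {n} {g = g} f≗g f≡true =
  trans (forallᵇ-split m f≗g f≡true)
        (trans (cong (forallᵇ g ∧_) (forallᵇ-true {n} (λ _ → refl))) (∧-identityʳ (forallᵇ g)))

forallᵇ-splitʳ : ∀ m {n} {f : Fin (m ℕ.+ n) → Bool} {h : Fin n → Bool} →
                 (∀ i → f (i ↑ˡ n) ≡ true) → f ∘ (m ↑ʳ_) ≗ h → forallᵇ f ≡ forallᵇ h
forallᵇ-splitʳ m {h = h} f≡true f≗h =
  trans (forallᵇ-split m f≡true f≗h) (cong (_∧ forallᵇ h) (forallᵇ-true {m} (λ _ → refl)))

does-≟-injective : ∀ {k l} {f : Fin k → Fin l} → (∀ a b → f a ≡ f b → a ≡ b) →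
                   ∀ a b → does (f a ≟ f b) ≡ does (a ≟ b)
does-≟-injective {f = f} f-injective a b with a ≟ b
... | yes refl = dec-true (f a ≟ f a) refl
... | no  a≢b  = dec-false (f a ≟ f b) (a≢b ∘ f-injective a b)

not-∧-false : ∀ x {r} → r ≡ false → not (x ∧ r) ≡ true
not-∧-false x refl = cong not (∧-zeroʳ x)

module DisjointUnion (P Q : FinPoset) where
  private
    m n : ℕ
    m = FinPoset.card P
    n = FinPoset.card Q
    module PN = PosetNotions P
    module QN = PosetNotions Q
    module SN = PosetNotions (P ⊕ Q)

  inl : Fin m → Fin (m ℕ.+ n)
  inl a = a ↑ˡ n

  inr : Fin n → Fin (m ℕ.+ n)
  inr b = m ↑ʳ b

  _≤⊕_ : Fin (m ℕ.+ n) → Fin (m ℕ.+ n) → Bool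
  _≤⊕_ = FinPoset._≤ᵇ_ (P ⊕ Q)

  inl-≤-inl : ∀ a b → inl a ≤⊕ inl b ≡ FinPoset._≤ᵇ_ P a b
  inl-≤-inl a b rewrite splitAt-↑ˡ m a n | splitAt-↑ˡ m b n = refl

  inr-≤-inr : ∀ a b → inr a ≤⊕ inr b ≡ FinPoset._≤ᵇ_ Q a b
  inr-≤-inr a b rewrite splitAt-↑ʳ m n a | splitAt-↑ʳ m n b = refl

  inl-≤-inr : ∀ a b → inl a ≤⊕ inr b ≡ false
  inl-≤-inr a b rewrite splitAt-↑ˡ m a n | splitAt-↑ʳ m n b = refl

  inr-≤-inl : ∀ a b → inr a ≤⊕ inl b ≡ false
  inr-≤-inl a b rewrite splitAt-↑ʳ m n a | splitAt-↑ˡ m b n = refl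

  inl-<-inl : ∀ a b → inl a SN.<ᵇ inl b ≡ a PN.<ᵇ b
  inl-<-inl a b =
    cong₂ (λ r e → r ∧ not e) (inl-≤-inl a b) (does-≟-injective (↑ˡ-injective n) a b)

  inr-<-inr : ∀ a b → inr a SN.<ᵇ inr b ≡ a QN.<ᵇ b
  inr-<-inr a b =
    cong₂ (λ r e → r ∧ not e) (inr-≤-inr a b) (does-≟-injective (↑ʳ-injective m) a b)

  inl-<-inr : ∀ a b → inl a SN.<ᵇ inr b ≡ false
  inl-<-inr a b rewrite inl-≤-inr a b = refl

  inr-<-inl : ∀ a b → inr a SN.<ᵇ inl b ≡ false
  inr-<-inl a b rewrite inr-≤-inl a b = refl

  module _ (S₁ : Vec Bool m) (S₂ : Vec Bool n) where
    private
      S : Vec Bool (m ℕ.+ n)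
      S = S₁ ++ S₂

    inAU-inl : ∀ a → SN.inAU S (inl a) ≡ PN.inAU S₁ a
    inAU-inl a = cong₂ _∧_ (lookup-++ˡ S₁ S₂ a)
      (forallᵇ-splitˡ m (λ v → cong₂ (λ x r → not (x ∧ r)) (lookup-++ˡ S₁ S₂ v) (inl-<-inl v a))
                        (λ w → not-∧-false (lookup S (inr w)) (inr-<-inl w a)))

    inAU-inr : ∀ b → SN.inAU S (inr b) ≡ QN.inAU S₂ b
    inAU-inr b = cong₂ _∧_ (lookup-++ʳ S₁ S₂ b)
      (forallᵇ-splitʳ m (λ v → not-∧-false (lookup S (inl v)) (inl-<-inr v b))
                        (λ w → cong₂ (λ x r → not (x ∧ r)) (lookup-++ʳ S₁ S₂ w) (inr-<-inr w b)))

    inAD-inl : ∀ a → SN.inAD S (inl a) ≡ PN.inAD S₁ a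
    inAD-inl a = cong₂ _∧_ (lookup-++ˡ S₁ S₂ a)
      (forallᵇ-splitˡ m (λ v → cong₂ (λ x r → not (x ∧ r)) (lookup-++ˡ S₁ S₂ v) (inl-<-inl a v))
                        (λ w → not-∧-false (lookup S (inr w)) (inl-<-inr a w)))

    inAD-inr : ∀ b → SN.inAD S (inr b) ≡ QN.inAD S₂ b
    inAD-inr b = cong₂ _∧_ (lookup-++ʳ S₁ S₂ b)
      (forallᵇ-splitʳ m (λ v → not-∧-false (lookup S (inl v)) (inr-<-inl b v))
                        (λ w → cong₂ (λ x r → not (x ∧ r)) (lookup-++ʳ S₁ S₂ w) (inr-<-inr b w)))

    forallᵇ-order-++ : (φ : Bool → Bool → Bool → Bool) → (∀ x y → φ x y false ≡ true) →
      forallᵇ (λ u → forallᵇ (λ v → φ (lookup S u) (lookup S v) (u ≤⊕ v)))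
        ≡ forallᵇ (λ u → forallᵇ (λ v → φ (lookup S₁ u) (lookup S₁ v) (FinPoset._≤ᵇ_ P u v)))
          ∧ forallᵇ (λ u → forallᵇ (λ v → φ (lookup S₂ u) (lookup S₂ v) (FinPoset._≤ᵇ_ Q u v)))
    forallᵇ-order-++ φ φ-unrelated =
      forallᵇ-split m (λ a → forallᵇ-splitˡ m (φ-inl-inl a) (φ-inl-inr a))
                      (λ a → forallᵇ-splitʳ m (φ-inr-inl a) (φ-inr-inr a))
      where
      φ-inl-inl : ∀ a b → φ (lookup S (inl a)) (lookup S (inl b)) (inl a ≤⊕ inl b)
                          ≡ φ (lookup S₁ a) (lookup S₁ b) (FinPoset._≤ᵇ_ P a b)
      φ-inl-inl a b rewrite lookup-++ˡ S₁ S₂ a | lookup-++ˡ S₁ S₂ b | inl-≤-inl a b = refl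
      φ-inr-inr : ∀ a b → φ (lookup S (inr a)) (lookup S (inr b)) (inr a ≤⊕ inr b)
                          ≡ φ (lookup S₂ a) (lookup S₂ b) (FinPoset._≤ᵇ_ Q a b)
      φ-inr-inr a b rewrite lookup-++ʳ S₁ S₂ a | lookup-++ʳ S₁ S₂ b | inr-≤-inr a b = refl
      φ-inl-inr : ∀ a b → φ (lookup S (inl a)) (lookup S (inr b)) (inl a ≤⊕ inr b) ≡ true
      φ-inl-inr a b rewrite inl-≤-inr a b = φ-unrelated _ _
      φ-inr-inl : ∀ a b → φ (lookup S (inr a)) (lookup S (inl b)) (inr a ≤⊕ inl b) ≡ true
      φ-inr-inl a b rewrite inr-≤-inl a b = φ-unrelated _ _

    isUpset-++ : SN.isUpset S ≡ PN.isUpset S₁ ∧ QN.isUpset S₂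
    isUpset-++ =
      forallᵇ-order-++ (λ x y r → (x ∧ r) ⇒ᵇ y) (λ x y → cong (_∨ y) (not-∧-false x refl))

    isDownset-++ : SN.isDownset S ≡ PN.isDownset S₁ ∧ QN.isDownset S₂
    isDownset-++ =
      forallᵇ-order-++ (λ x y r → (y ∧ r) ⇒ᵇ x) (λ x y → cong (_∨ x) (not-∧-false y refl))

    count-∈-++ : count (lookup S) ≡ count (lookup S₁) ℕ.+ count (lookup S₂)
    count-∈-++ = count-split m (lookup-++ˡ S₁ S₂) (lookup-++ʳ S₁ S₂)

    count-inAU-++ : count (SN.inAU S) ≡ count (PN.inAU S₁) ℕ.+ count (QN.inAU S₂)
    count-inAU-++ = count-split m inAU-inl inAU-inr

    count-inAD-++ : count (SN.inAD S) ≡ count (PN.inAD S₁) ℕ.+ count (QN.inAD S₂)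
    count-inAD-++ = count-split m inAD-inl inAD-inr

  module _ (U₁ D₁ : Vec Bool m) (U₂ D₂ : Vec Bool n) where
    private
      U D : Vec Bool (m ℕ.+ n)
      U = U₁ ++ U₂
      D = D₁ ++ D₂

    count-∩-++ : count (λ i → lookup U i ∧ lookup D i)
                 ≡ count (λ i → lookup U₁ i ∧ lookup D₁ i) ℕ.+ count (λ i → lookup U₂ i ∧ lookup D₂ i)
    count-∩-++ = count-split m (λ a → cong₂ _∧_ (lookup-++ˡ U₁ U₂ a) (lookup-++ˡ D₁ D₂ a))
                               (λ b → cong₂ _∧_ (lookup-++ʳ U₁ U₂ b) (lookup-++ʳ D₁ D₂ b))

    ≼-++ : U SN.≼ D ≡ (U₁ PN.≼ D₁) ∧ (U₂ QN.≼ D₂)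
    ≼-++ = trans
      (cong₂ _∧_
        (forallᵇ-split m (λ a → cong₂ _⇒ᵇ_ (inAU-inl U₁ U₂ a) (lookup-++ˡ D₁ D₂ a))
                         (λ b → cong₂ _⇒ᵇ_ (inAU-inr U₁ U₂ b) (lookup-++ʳ D₁ D₂ b)))
        (forallᵇ-split m (λ a → cong₂ _⇒ᵇ_ (inAD-inl D₁ D₂ a) (lookup-++ˡ U₁ U₂ a))
                         (λ b → cong₂ _⇒ᵇ_ (inAD-inr D₁ D₂ b) (lookup-++ʳ U₁ U₂ b))))
      (∧-interchange (forallᵇ (λ u → PN.inAU U₁ u ⇒ᵇ lookup D₁ u))
                     (forallᵇ (λ u → QN.inAU U₂ u ⇒ᵇ lookup D₂ u))
                     (forallᵇ (λ d → PN.inAD D₁ d ⇒ᵇ lookup U₁ d))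
                     (forallᵇ (λ d → QN.inAD D₂ d ⇒ᵇ lookup U₂ d)))

    admissible-++ : SN.admissible (U , D) ≡ PN.admissible (U₁ , D₁) ∧ QN.admissible (U₂ , D₂)
    admissible-++ = trans
      (cong₂ _∧_ (isUpset-++ U₁ U₂) (cong₂ _∧_ (isDownset-++ D₁ D₂) ≼-++))
      (trans (cong ((PN.isUpset U₁ ∧ QN.isUpset U₂) ∧_)
                   (∧-interchange (PN.isDownset D₁) (QN.isDownset D₂) (U₁ PN.≼ D₁) (U₂ QN.≼ D₂)))
             (∧-interchange (PN.isUpset U₁) (QN.isUpset U₂)
                            (PN.isDownset D₁ ∧ (U₁ PN.≼ D₁)) (QN.isDownset D₂ ∧ (U₂ QN.≼ D₂))))

allSubsets-+ : ∀ m n →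
               allSubsets (m ℕ.+ n) ≡ concatMap (λ a → map (a ++_) (allSubsets n)) (allSubsets m)
allSubsets-+ zero    n = sym (trans (++-identityʳ _) (map-id (allSubsets n)))
allSubsets-+ (suc m) n = begin
  map (false ∷_) (allSubsets (m ℕ.+ n)) ++ᴸ map (true ∷_) (allSubsets (m ℕ.+ n))
    ≡⟨ cong₂ _++ᴸ_ (cons-allSubsets-+ false) (cons-allSubsets-+ true) ⟩
  concatMap extend (map (false ∷_) (allSubsets m))
    ++ᴸ concatMap extend (map (true ∷_) (allSubsets m))
    ≡⟨ concatMap-++ extend (map (false ∷_) (allSubsets m)) (map (true ∷_) (allSubsets m)) ⟨
  concatMap extend (allSubsets (suc m)) ∎
  where
  open ≡-Reasoning

  extend : ∀ {k} → Vec Bool k → List (Vec Bool (k ℕ.+ n))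
  extend a = map (a ++_) (allSubsets n)

  cons-allSubsets-+ : ∀ b →
    map (b ∷_) (allSubsets (m ℕ.+ n)) ≡ concatMap extend (map (b ∷_) (allSubsets m))
  cons-allSubsets-+ b = begin
    map (b ∷_) (allSubsets (m ℕ.+ n))
      ≡⟨ cong (map (b ∷_)) (allSubsets-+ m n) ⟩
    map (b ∷_) (concatMap extend (allSubsets m))
      ≡⟨ map-concatMap (b ∷_) extend (allSubsets m) ⟩
    concatMap (map (b ∷_) ∘ extend) (allSubsets m)
      ≡⟨ concatMap-cong (λ a → sym (map-∘ (allSubsets n))) (allSubsets m) ⟩
    concatMap (extend ∘ (b ∷_)) (allSubsets m)
      ≡⟨ concatMap-map extend (b ∷_) (allSubsets m) ⟨
    concatMap extend (map (b ∷_) (allSubsets m)) ∎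

subsetPairs : (k : ℕ) → List (Vec Bool k × Vec Bool k)
subsetPairs k = concatMap (λ U → map (U ,_) (allSubsets k)) (allSubsets k)

_++²_ : ∀ {m n} → Vec Bool m × Vec Bool m → Vec Bool n × Vec Bool n →
        Vec Bool (m ℕ.+ n) × Vec Bool (m ℕ.+ n)
(U₁ , D₁) ++² (U₂ , D₂) = (U₁ ++ U₂ , D₁ ++ D₂)

module ListSum {c ℓ} (R : CommutativeSemiring c ℓ) where
  open CommutativeSemiring R
    renaming (Carrier to A; refl to ≈-refl; sym to ≈-sym; trans to ≈-trans)
  open CommutativeSemigroupProperties +-commutativeSemigroup
    using () renaming (interchange to +-interchange)
  open SetoidReasoning setoid

  private
    variable
      X Y : Set

  ∑ : List X → (X → A) → A
  ∑ xs f = foldr _+_ 0# (map f xs)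

  syntax ∑ xs (λ x → e) = ∑[ x ∈ xs ] e

  ∑-cong : ∀ (xs : List X) {f g : X → A} → (∀ x → f x ≈ g x) → ∑ xs f ≈ ∑ xs g
  ∑-cong []       f≈g = ≈-refl
  ∑-cong (x ∷ xs) f≈g = +-cong (f≈g x) (∑-cong xs f≈g)

  ∑-++ : ∀ (xs ys : List X) f → ∑ (xs ++ᴸ ys) f ≈ ∑ xs f + ∑ ys f
  ∑-++ []       ys f = ≈-sym (+-identityˡ _)
  ∑-++ (x ∷ xs) ys f = ≈-trans (+-congˡ (∑-++ xs ys f)) (≈-sym (+-assoc (f x) _ _))

  ∑-map : ∀ (g : X → Y) xs (f : Y → A) → ∑ (map g xs) f ≡ ∑ xs (f ∘ g)
  ∑-map g xs f = cong (foldr _+_ 0#) (sym (map-∘ xs))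

  ∑-concatMap : ∀ (g : X → List Y) xs f → ∑ (concatMap g xs) f ≈ ∑[ x ∈ xs ] ∑ (g x) f
  ∑-concatMap g []       f = ≈-refl
  ∑-concatMap g (x ∷ xs) f = ≈-trans (∑-++ (g x) (concatMap g xs) f) (+-congˡ (∑-concatMap g xs f))

  ∑-filter : ∀ (b : X → Bool) xs f →
             ∑ (filter (λ x → T? (b x)) xs) f ≈ ∑[ x ∈ xs ] (if b x then f x else 0#)
  ∑-filter b []       f = ≈-refl
  ∑-filter b (x ∷ xs) f with b x
  ... | true  = +-congˡ (∑-filter b xs f)
  ... | false = ≈-trans (∑-filter b xs f) (≈-sym (+-identityˡ _))

  ∑-zero : ∀ (xs : List X) → ∑[ x ∈ xs ] 0# ≈ 0#
  ∑-zero []       = ≈-refl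
  ∑-zero (x ∷ xs) = ≈-trans (+-identityˡ _) (∑-zero xs)

  ∑-distrib-+ : ∀ (xs : List X) f g → ∑[ x ∈ xs ] (f x + g x) ≈ ∑ xs f + ∑ xs g
  ∑-distrib-+ []       f g = ≈-sym (+-identityˡ 0#)
  ∑-distrib-+ (x ∷ xs) f g =
    ≈-trans (+-congˡ (∑-distrib-+ xs f g)) (+-interchange (f x) (g x) (∑ xs f) (∑ xs g))

  ∑-comm : ∀ (xs : List X) (ys : List Y) (f : X → Y → A) →
           ∑[ x ∈ xs ] ∑[ y ∈ ys ] f x y ≈ ∑[ y ∈ ys ] ∑[ x ∈ xs ] f x y
  ∑-comm []       ys f = ≈-sym (∑-zero ys)
  ∑-comm (x ∷ xs) ys f =
    ≈-trans (+-congˡ (∑-comm xs ys f)) (≈-sym (∑-distrib-+ ys (f x) (λ y → ∑[ x′ ∈ xs ] f x′ y)))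

  *-distribˡ-∑ : ∀ k (xs : List X) f → k * ∑ xs f ≈ ∑[ x ∈ xs ] (k * f x)
  *-distribˡ-∑ k []       f = zeroʳ k
  *-distribˡ-∑ k (x ∷ xs) f = ≈-trans (distribˡ k (f x) (∑ xs f)) (+-congˡ (*-distribˡ-∑ k xs f))

  *-distribʳ-∑ : ∀ k (xs : List X) f → ∑ xs f * k ≈ ∑[ x ∈ xs ] (f x * k)
  *-distribʳ-∑ k []       f = zeroˡ k
  *-distribʳ-∑ k (x ∷ xs) f = ≈-trans (distribʳ k (f x) (∑ xs f)) (+-congˡ (*-distribʳ-∑ k xs f))

  ∑-product : ∀ (xs : List X) (ys : List Y) f g →
              ∑ xs f * ∑ ys g ≈ ∑[ x ∈ xs ] ∑[ y ∈ ys ] (f x * g y)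
  ∑-product xs ys f g =
    ≈-trans (*-distribʳ-∑ (∑ ys g) xs f) (∑-cong xs (λ x → *-distribˡ-∑ (f x) ys g))

  ∑-allSubsets-+ : ∀ m n f →
    ∑ (allSubsets (m ℕ.+ n)) f ≈ ∑[ a ∈ allSubsets m ] ∑[ b ∈ allSubsets n ] f (a ++ b)
  ∑-allSubsets-+ m n f = begin
    ∑ (allSubsets (m ℕ.+ n)) f
      ≡⟨ cong (λ xs → ∑ xs f) (allSubsets-+ m n) ⟩
    ∑ (concatMap (λ a → map (a ++_) (allSubsets n)) (allSubsets m)) f
      ≈⟨ ∑-concatMap _ (allSubsets m) f ⟩
    ∑[ a ∈ allSubsets m ] ∑ (map (a ++_) (allSubsets n)) f
      ≈⟨ ∑-cong (allSubsets m) (λ a → reflexive (∑-map (a ++_) (allSubsets n) f)) ⟩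
    ∑[ a ∈ allSubsets m ] ∑[ b ∈ allSubsets n ] f (a ++ b) ∎

  ∑-subsetPairs : ∀ k f →
    ∑ (subsetPairs k) f ≈ ∑[ U ∈ allSubsets k ] ∑[ D ∈ allSubsets k ] f (U , D)
  ∑-subsetPairs k f =
    ≈-trans (∑-concatMap _ (allSubsets k) f)
          (∑-cong (allSubsets k) (λ U → reflexive (∑-map (U ,_) (allSubsets k) f)))

  ∑-subsetPairs-+ : ∀ m n f →
    ∑ (subsetPairs (m ℕ.+ n)) f ≈ ∑[ p ∈ subsetPairs m ] ∑[ q ∈ subsetPairs n ] f (p ++² q)
  ∑-subsetPairs-+ m n f = begin
    ∑ (subsetPairs (m ℕ.+ n)) f
      ≈⟨ ∑-subsetPairs (m ℕ.+ n) f ⟩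
    ∑[ U ∈ allSubsets (m ℕ.+ n) ] ∑[ D ∈ allSubsets (m ℕ.+ n) ] f (U , D)
      ≈⟨ ∑-cong (allSubsets (m ℕ.+ n)) (λ U → ∑-allSubsets-+ m n (λ D → f (U , D))) ⟩
    ∑[ U ∈ allSubsets (m ℕ.+ n) ] ∑[ D₁ ∈ Sm ] ∑[ D₂ ∈ Sn ] f (U , D₁ ++ D₂)
      ≈⟨ ∑-allSubsets-+ m n _ ⟩
    ∑[ U₁ ∈ Sm ] ∑[ U₂ ∈ Sn ] ∑[ D₁ ∈ Sm ] ∑[ D₂ ∈ Sn ] f (U₁ ++ U₂ , D₁ ++ D₂)
      ≈⟨ ∑-cong Sm (λ U₁ → ∑-comm Sn Sm _) ⟩
    ∑[ U₁ ∈ Sm ] ∑[ D₁ ∈ Sm ] ∑[ U₂ ∈ Sn ] ∑[ D₂ ∈ Sn ] f (U₁ ++ U₂ , D₁ ++ D₂)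
      ≈⟨ ∑-cong Sm (λ U₁ → ∑-cong Sm (λ D₁ → ∑-subsetPairs n (λ q → f ((U₁ , D₁) ++² q)))) ⟨
    ∑[ U₁ ∈ Sm ] ∑[ D₁ ∈ Sm ] ∑[ q ∈ subsetPairs n ] f ((U₁ , D₁) ++² q)
      ≈⟨ ∑-subsetPairs m _ ⟨
    ∑[ p ∈ subsetPairs m ] ∑[ q ∈ subsetPairs n ] f (p ++² q) ∎
    where
    Sm : List (Vec Bool m)
    Sm = allSubsets m
    Sn : List (Vec Bool n)
    Sn = allSubsets n

module PowerProducts {c ℓ} (R : CommutativeSemiring c ℓ) where
  open CommutativeSemiring R hiding (refl) renaming (Carrier to A; sym to ≈-sym; trans to ≈-trans)
  open CommutativeSemigroupProperties *-commutativeSemigroup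
    using () renaming (interchange to *-interchange)

  pow-+ : ∀ a k l → pow R a (k ℕ.+ l) ≈ pow R a k * pow R a l
  pow-+ a zero    l = ≈-sym (*-identityˡ _)
  pow-+ a (suc k) l = ≈-trans (*-congˡ (pow-+ a k l)) (≈-sym (*-assoc a _ _))

  -- k₁ and k₂ are explicit: ℕ._+_ is not injective, so they cannot be read off the equation.
  pow-split : ∀ a {k} k₁ k₂ → k ≡ k₁ ℕ.+ k₂ → pow R a k ≈ pow R a k₁ * pow R a k₂
  pow-split a k₁ k₂ refl = pow-+ a k₁ k₂

  *-interchange⁵ : ∀ a a′ b b′ c c′ d d′ e e′ →
    (a * a′) * (b * b′) * (c * c′) * (d * d′) * (e * e′)
      ≈ (a * b * c * d * e) * (a′ * b′ * c′ * d′ * e′)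
  *-interchange⁵ a a′ b b′ c c′ d d′ e e′ =
    ≈-trans (*-congʳ (*-congʳ (*-congʳ (*-interchange a a′ b b′))))
    (≈-trans (*-congʳ (*-congʳ (*-interchange (a * b) (a′ * b′) c c′)))
    (≈-trans (*-congʳ (*-interchange (a * b * c) (a′ * b′ * c′) d d′))
             (*-interchange (a * b * c * d) (a′ * b′ * c′ * d′) e e′)))

module IntervalPolynomial {c ℓ} (R : CommutativeSemiring c ℓ) (s t x y z : CommutativeSemiring.Carrier R)
  where
  open CommutativeSemiring R renaming (Carrier to A; trans to ≈-trans; sym to ≈-sym)
  open ListSum R
  open PowerProducts R

  weight : (X : FinPoset) → PosetNotions.Sub X × PosetNotions.Sub X → A
  weight X (U , D) =
    pow R s (count (inAU U)) * pow R t (count (inAD D)) * pow R x (count (_∈ᵇ D))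
    * pow R y (count (_∈ᵇ U)) * pow R z (count (λ i → (i ∈ᵇ U) ∧ (i ∈ᵇ D)))
    where open PosetNotions X

  summand : (X : FinPoset) → PosetNotions.Sub X × PosetNotions.Sub X → A
  summand X p = if PosetNotions.admissible X p then weight X p else 0#

  Φ-as-∑ : ∀ X → Φ R X s t x y z ≈ ∑ (subsetPairs (FinPoset.card X)) (summand X)
  Φ-as-∑ X = ∑-filter (PosetNotions.admissible X) (subsetPairs (FinPoset.card X)) (weight X)

  module _ (P Q : FinPoset) where
    open DisjointUnion P Q
    private
      module PN = PosetNotions P
      module QN = PosetNotions Q

    weight-++ : ∀ (U₁ D₁ : PN.Sub) (U₂ D₂ : QN.Sub) →
      weight (P ⊕ Q) ((U₁ , D₁) ++² (U₂ , D₂)) ≈ weight P (U₁ , D₁) * weight Q (U₂ , D₂)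
    weight-++ U₁ D₁ U₂ D₂ = ≈-trans
      (*-cong (*-cong (*-cong (*-cong
        (pow-split s (count (PN.inAU U₁)) (count (QN.inAU U₂)) (count-inAU-++ U₁ U₂))
        (pow-split t (count (PN.inAD D₁)) (count (QN.inAD D₂)) (count-inAD-++ D₁ D₂)))
        (pow-split x (count (lookup D₁)) (count (lookup D₂)) (count-∈-++ D₁ D₂)))
        (pow-split y (count (lookup U₁)) (count (lookup U₂)) (count-∈-++ U₁ U₂)))
        (pow-split z (count (λ i → lookup U₁ i ∧ lookup D₁ i))
                     (count (λ i → lookup U₂ i ∧ lookup D₂ i))
                     (count-∩-++ U₁ D₁ U₂ D₂)))
      (*-interchange⁵ _ _ _ _ _ _ _ _ _ _)

    summand-++ : ∀ (p : PN.Sub × PN.Sub) (q : QN.Sub × QN.Sub) →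
                 summand (P ⊕ Q) (p ++² q) ≈ summand P p * summand Q q
    summand-++ (U₁ , D₁) (U₂ , D₂) rewrite admissible-++ U₁ D₁ U₂ D₂
      with PN.admissible (U₁ , D₁) | QN.admissible (U₂ , D₂)
    ... | true  | true  = weight-++ U₁ D₁ U₂ D₂
    ... | true  | false = ≈-sym (zeroʳ _)
    ... | false | _     = ≈-sym (zeroˡ _)

mainTheorem1 : ∀ {c ℓ} (R : CommutativeSemiring c ℓ) (P Q : FinPoset)
                 (s t x y z : CommutativeSemiring.Carrier R) →
                 CommutativeSemiring._≈_ R (Φ R (P ⊕ Q) s t x y z)
                   (CommutativeSemiring._*_ R (Φ R P s t x y z) (Φ R Q s t x y z))
mainTheorem1 R P Q s t x y z = begin
  Φ R (P ⊕ Q) s t x y z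
    ≈⟨ Φ-as-∑ (P ⊕ Q) ⟩
  ∑ (subsetPairs (m ℕ.+ n)) (summand (P ⊕ Q))
    ≈⟨ ∑-subsetPairs-+ m n (summand (P ⊕ Q)) ⟩
  ∑[ p ∈ subsetPairs m ] ∑[ q ∈ subsetPairs n ] summand (P ⊕ Q) (p ++² q)
    ≈⟨ ∑-cong (subsetPairs m) (λ p → ∑-cong (subsetPairs n) (summand-++ P Q p)) ⟩
  ∑[ p ∈ subsetPairs m ] ∑[ q ∈ subsetPairs n ] (summand P p * summand Q q)
    ≈⟨ ∑-product (subsetPairs m) (subsetPairs n) (summand P) (summand Q) ⟨
  ∑ (subsetPairs m) (summand P) * ∑ (subsetPairs n) (summand Q)
    ≈⟨ *-cong (Φ-as-∑ P) (Φ-as-∑ Q) ⟨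
  Φ R P s t x y z * Φ R Q s t x y z ∎
  where
  open CommutativeSemiring R using (_*_; *-cong; setoid)
  open ListSum R
  open IntervalPolynomial R s t x y z
  open SetoidReasoning setoid
  m n : ℕ
  m = FinPoset.card P
  n = FinPoset.card Q
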